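{- Let $\gamma$ be an infinite limit ordinal and $n$ a positive integer. Let $u$ be any vertex of $\mathcal G_{\gamma+n}$ and $v\in\gamma\times\gamma$. Then $\eta(u,v)\leq\gamma+1$. Moreover, $\eta(u,(0,0))<\gamma$.
   Context: $\mathcal G_\gamma$ is the graph with vertex set $\gamma\times\gamma$ in which two distinct vertices $(\alpha_0,\beta_0),(\alpha_1,\beta_1)$ are adjacent iff $\alpha_0=\alpha_1=0$, or $\beta_0=\beta_1=0$, or ($\alpha_0=\beta_0$ and $\alpha_1=\beta_1$), or ($\alpha_0<\alpha_1$ and $\beta_0>\beta_1$), or ($\alpha_0>\alpha_1$ and $\beta_0<\beta_1$). $\mathcal G_{\gamma+n}$ is the graph with vertex set $(\gamma\times\gamma)\cup(\{ -(n+1),\dots,-1\}\times\{0\})$ whose edges are all edges of $\mathcal G_\gamma$ together with the pairs $\{(-i,0),(-i+1,0)\}$ for $i=1,\dots,n+1$. $N[v]$ is the closed neighbourhood of $v$. Relations $\leq_\alpha$ on the vertex set for ordinals $\alpha$: $u\leq_0 v$ iff $u=v$; $u\leq_\alpha v$ if for every $x\in N[u]$ there is $y\in N[v]$ with $x\leq_\delta y$ for some $\delta<\alpha$. $\eta(u,v)$ is the minimum ordinal $\alpha$ with $u\leq_\alpha v$, computed in $\mathcal G_{\gamma+n}$. -}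

module Defs where

open import Data.Nat using (ℕ; zero; suc)
open import Data.Fin using (Fin; toℕ)
import Data.Fin as F
open import Data.Product using (Σ; _×_; ∃)
open import Data.Sum using (_⊎_)
open import Data.Empty using (⊥)
open import Data.Unit using (⊤)
open import Relation.Nullary using (¬_)
open import Relation.Binary.PropositionalEquality using (_≡_)
open import Relation.Binary using (Rel; IsStrictTotalOrder)
open import Induction.WellFounded using (WellFounded)

-- An ordinal, presented as a (strict) well-ordered set: a strict total
-- order (w.r.t. ≡) which is well-founded, together with its least element 0.
record Ordinal : Set₁ where
  field
    Carrier  : Set
    _<_      : Rel Carrier _
    isSTO    : IsStrictTotalOrder _≡_ _<_
    wf       : WellFounded _<_
    𝟘        : Carrier
    𝟘-least  : ∀ a → ¬ (a < 𝟘)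

-- γ is an infinite limit ordinal: it is nonzero (it has the element 𝟘)
-- and has no largest element.
IsInfiniteLimit : Ordinal → Set
IsInfiniteLimit γ = ∀ a → ∃ λ b → a < b
  where open Ordinal γ

module Graph (γ : Ordinal) (n : ℕ) where
  open Ordinal γ

  -- vertices of G_{γ+n}: pairs (a , b) ∈ γ × γ, and neg k = (-(k+1) , 0)
  -- for k ∈ {0,…,n}.
  data V : Set where
    pt  : Carrier → Carrier → V
    neg : Fin (suc n) → V

  Adj : V → V → Set
  Adj (pt a₀ b₀) (pt a₁ b₁) =
    ¬ (a₀ ≡ a₁ × b₀ ≡ b₁) ×
    ( (a₀ ≡ 𝟘 × a₁ ≡ 𝟘)
    ⊎ (b₀ ≡ 𝟘 × b₁ ≡ 𝟘)
    ⊎ (a₀ ≡ b₀ × a₁ ≡ b₁)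
    ⊎ (a₀ < a₁ × b₀ > b₁)
    ⊎ (a₀ > a₁ × b₀ < b₁))
    where _>_ = λ x y → y < x
  Adj (pt a b) (neg k) = a ≡ 𝟘 × b ≡ 𝟘 × k ≡ F.zero
  Adj (neg k) (pt a b) = a ≡ 𝟘 × b ≡ 𝟘 × k ≡ F.zero
  Adj (neg j) (neg k) = toℕ j ≡ suc (toℕ k) ⊎ toℕ k ≡ suc (toℕ j)

  N[_]∋_ : V → V → Set
  N[ u ]∋ x = x ≡ u ⊎ Adj u x

  -- The ordinals ≤ γ+1, i.e. the initial segment γ+2 = γ ∪ {γ, γ+1}.
  data Idx : Set where
    ↑    : Carrier → Idx
    γ̂    : Idx
    γ̂+1  : Idx

  data _<ᵢ_ : Idx → Idx → Set where
    ↑<↑   : ∀ {a b} → a < b → ↑ a <ᵢ ↑ b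
    ↑<γ   : ∀ {a} → ↑ a <ᵢ γ̂
    ↑<γ+1 : ∀ {a} → ↑ a <ᵢ γ̂+1
    γ<γ+1 : γ̂ <ᵢ γ̂+1

  -- u ≤_α v (for α ≤ γ+1): u ≤_0 v iff u = v; otherwise
  -- for every x ∈ N[u] there are y ∈ N[v] and δ < α with x ≤_δ y.
  -- (At α = 0 the second clause is impossible; at α > 0 the first
  -- clause is implied by the second, so this is the paper's definition.)
  data _≤[_]_ : V → Idx → V → Set where
    refl≤ : ∀ {u α} → u ≤[ α ] u
    step  : ∀ {u α v} →
            (∀ x → N[ u ]∋ x →
               Σ V λ y → N[ v ]∋ y × Σ Idx λ δ → δ <ᵢ α × x ≤[ δ ] y) →
            u ≤[ α ] v

-- A point (c,d) with
-- 0 < c < d is beaten by a column vertex (0,q), q > d, by descent on c: each of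
-- its neighbours outside N[(0,q)] is some (c',d') with c' < c, which recurses to
-- a column q' above it. Rows are symmetric, points on the axes or the diagonal
-- already lie in N[o], and the path vertices need only finitely many rounds.
-- Since (a,b) has the neighbour (0,q), q > b, which is itself adjacent to o,
-- every vertex is then ≤_{γ+1} (a,b).
module Submission where

open import Defs
open import Data.Nat using (ℕ; _≤_)
open import Data.Product using (Σ; _×_)

import Data.Nat as ℕ
import Data.Nat.Properties as ℕ
open import Data.Fin using (Fin; toℕ; fromℕ<)
import Data.Fin as Fin
import Data.Fin.Properties as Fin
open import Data.Product using (_,_; proj₁; proj₂; ∃)
open import Data.Sum using (_⊎_; inj₁; inj₂; [_,_]′)
open import Data.Empty using (⊥-elim)
open import Function using (id; _∘_)
open import Relation.Nullary using (yes; no)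
open import Relation.Binary using (IsStrictTotalOrder; tri<; tri≈; tri>)
open import Relation.Binary.PropositionalEquality
  using (_≡_; _≢_; refl; sym; trans; cong; subst)
open import Induction.WellFounded using (Acc; acc)

module OrdinalProperties (γ : Ordinal) where
  open Ordinal γ
  open IsStrictTotalOrder isSTO public
    using (compare; _≟_; _<?_) renaming (trans to <-trans; irrefl to <-irrefl)

  <⇒≢𝟘 : ∀ {a b} → a < b → b ≢ 𝟘
  <⇒≢𝟘 {a} a<b refl = 𝟘-least a a<b

  ≢𝟘⇒𝟘< : ∀ {a} → a ≢ 𝟘 → 𝟘 < a
  ≢𝟘⇒𝟘< {a} a≢𝟘 with compare 𝟘 a
  ... | tri< 𝟘<a _ _ = 𝟘<a
  ... | tri≈ _ 𝟘≡a _ = ⊥-elim (a≢𝟘 (sym 𝟘≡a))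
  ... | tri> _ _ a<𝟘 = ⊥-elim (𝟘-least a a<𝟘)

  <⇒𝟘< : ∀ {a b} → a < b → 𝟘 < b
  <⇒𝟘< {a} a<b with a ≟ 𝟘
  ... | yes refl = a<b
  ... | no a≢𝟘 = <-trans (≢𝟘⇒𝟘< a≢𝟘) a<b

  module Unbounded (lim : IsInfiniteLimit γ) where

    next : Carrier → Carrier
    next a = proj₁ (lim a)

    <-next : ∀ a → a < next a
    <-next a = proj₂ (lim a)

    upper-bound : ∀ a b → ∃ λ s → a < s × b < s
    upper-bound a b with compare a b
    ... | tri< a<b _ _ = next b , <-trans a<b (<-next b) , <-next b
    ... | tri≈ _ refl _ = next a , <-next a , <-next a
    ... | tri> _ _ b<a = next a , <-next a , <-trans b<a (<-next a)

    finite : ℕ → Carrier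
    finite ℕ.zero = 𝟘
    finite (ℕ.suc m) = next (finite m)

module GraphProperties (γ : Ordinal) (n : ℕ) where
  open Ordinal γ
  open Graph γ n
  open OrdinalProperties γ

  PointEdge : Carrier → Carrier → Carrier → Carrier → Set
  PointEdge a₀ b₀ a₁ b₁ =
    (a₀ ≡ 𝟘 × a₁ ≡ 𝟘) ⊎ (b₀ ≡ 𝟘 × b₁ ≡ 𝟘) ⊎ (a₀ ≡ b₀ × a₁ ≡ b₁) ⊎
    (a₀ < a₁ × b₁ < b₀) ⊎ (a₁ < a₀ × b₀ < b₁)

  PointEdge-sym : ∀ {a₀ b₀ a₁ b₁} → PointEdge a₀ b₀ a₁ b₁ → PointEdge a₁ b₁ a₀ b₀
  PointEdge-sym (inj₁ (a₀≡𝟘 , a₁≡𝟘)) = inj₁ (a₁≡𝟘 , a₀≡𝟘)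
  PointEdge-sym (inj₂ (inj₁ (b₀≡𝟘 , b₁≡𝟘))) = inj₂ (inj₁ (b₁≡𝟘 , b₀≡𝟘))
  PointEdge-sym (inj₂ (inj₂ (inj₁ (diag₀ , diag₁)))) = inj₂ (inj₂ (inj₁ (diag₁ , diag₀)))
  PointEdge-sym (inj₂ (inj₂ (inj₂ (inj₁ anti)))) = inj₂ (inj₂ (inj₂ (inj₂ anti)))
  PointEdge-sym (inj₂ (inj₂ (inj₂ (inj₂ anti)))) = inj₂ (inj₂ (inj₂ (inj₁ anti)))

  PointEdge-transpose : ∀ {a₀ b₀ a₁ b₁} → PointEdge a₀ b₀ a₁ b₁ → PointEdge b₀ a₀ b₁ a₁
  PointEdge-transpose (inj₁ axis) = inj₂ (inj₁ axis)
  PointEdge-transpose (inj₂ (inj₁ axis)) = inj₁ axis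
  PointEdge-transpose (inj₂ (inj₂ (inj₁ (diag₀ , diag₁)))) =
    inj₂ (inj₂ (inj₁ (sym diag₀ , sym diag₁)))
  PointEdge-transpose (inj₂ (inj₂ (inj₂ (inj₁ (a< , b>))))) = inj₂ (inj₂ (inj₂ (inj₂ (b> , a<))))
  PointEdge-transpose (inj₂ (inj₂ (inj₂ (inj₂ (a> , b<))))) = inj₂ (inj₂ (inj₂ (inj₁ (b< , a>))))

  Adj-sym : ∀ {u v} → Adj u v → Adj v u
  Adj-sym {pt _ _} {pt _ _} (u≢v , edge) =
    (λ (a≡ , b≡) → u≢v (sym a≡ , sym b≡)) , PointEdge-sym edge
  Adj-sym {pt _ _} {neg _} edge = edge
  Adj-sym {neg _} {pt _ _} edge = edge
  Adj-sym {neg _} {neg _} edge = [ inj₂ , inj₁ ]′ edge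

  N-sym : ∀ {u x} → N[ u ]∋ x → N[ x ]∋ u
  N-sym (inj₁ refl) = inj₁ refl
  N-sym (inj₂ edge) = inj₂ (Adj-sym edge)

  transpose : V → V
  transpose (pt a b) = pt b a
  transpose (neg k) = neg k

  transpose-involutive : ∀ u → transpose (transpose u) ≡ u
  transpose-involutive (pt _ _) = refl
  transpose-involutive (neg _) = refl

  Adj-transpose : ∀ {u v} → Adj u v → Adj (transpose u) (transpose v)
  Adj-transpose {pt _ _} {pt _ _} (u≢v , edge) =
    (λ (b≡ , a≡) → u≢v (a≡ , b≡)) , PointEdge-transpose edge
  Adj-transpose {pt _ _} {neg _} (a≡𝟘 , b≡𝟘 , k≡0) = b≡𝟘 , a≡𝟘 , k≡0
  Adj-transpose {neg _} {pt _ _} (a≡𝟘 , b≡𝟘 , k≡0) = b≡𝟘 , a≡𝟘 , k≡0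
  Adj-transpose {neg _} {neg _} edge = edge

  N-transpose : ∀ {u x} → N[ u ]∋ x → N[ transpose u ]∋ transpose x
  N-transpose (inj₁ refl) = inj₁ refl
  N-transpose (inj₂ edge) = inj₂ (Adj-transpose edge)

  infix 4 _≤[<_]N[_]
  _≤[<_]N[_] : V → Idx → V → Set
  x ≤[< α ]N[ v ] = Σ V λ y → N[ v ]∋ y × Σ Idx λ δ → δ <ᵢ α × x ≤[ δ ] y

  ∈N⇒≤[<]N : ∀ {x v s} → N[ v ]∋ x → 𝟘 < s → x ≤[< ↑ s ]N[ v ]
  ∈N⇒≤[<]N {x} x∈N 𝟘<s = x , x∈N , ↑ 𝟘 , ↑<↑ 𝟘<s , refl≤

  mutual
    ≤-transpose : ∀ {u α v} → u ≤[ α ] v → transpose u ≤[ α ] transpose v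
    ≤-transpose refl≤ = refl≤
    ≤-transpose {u} {α} {v} (step beaten) = step λ x x∈N →
      subst (_≤[< α ]N[ transpose v ]) (transpose-involutive x)
        (≤[<]N-transpose (beaten (transpose x)
          (subst (N[_]∋ transpose x) (transpose-involutive u) (N-transpose x∈N))))

    ≤[<]N-transpose : ∀ {x α v} → x ≤[< α ]N[ v ] → transpose x ≤[< α ]N[ transpose v ]
    ≤[<]N-transpose (y , y∈N , δ , δ<α , x≤y) =
      transpose y , N-transpose y∈N , δ , δ<α , ≤-transpose x≤y

  row-member : ∀ {c p} → N[ pt p 𝟘 ]∋ pt c 𝟘
  row-member {c} {p} with c ≟ p
  ... | yes refl = inj₁ refl
  ... | no c≢p = inj₂ ((λ (p≡c , _) → c≢p (sym p≡c)) , inj₂ (inj₁ (refl , refl)))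

  row-neighbour : ∀ {c d p} → d ≡ 𝟘 ⊎ c < p → N[ pt p 𝟘 ]∋ pt c d
  row-neighbour (inj₁ refl) = row-member
  row-neighbour {d = d} (inj₂ c<p) with d ≟ 𝟘
  ... | yes refl = row-member
  ... | no d≢𝟘 = inj₂ ((λ (p≡c , _) → <-irrefl (sym p≡c) c<p) ,
                     inj₂ (inj₂ (inj₂ (inj₂ (c<p , ≢𝟘⇒𝟘< d≢𝟘)))))

  column-neighbour : ∀ {c d q} → c ≡ 𝟘 ⊎ d < q → N[ pt 𝟘 q ]∋ pt c d
  column-neighbour = N-transpose ∘ row-neighbour

  origin : V
  origin = pt 𝟘 𝟘

  origin-neighbour : ∀ {c d} → c ≡ 𝟘 ⊎ d ≡ 𝟘 ⊎ c ≡ d → N[ origin ]∋ pt c d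
  origin-neighbour (inj₁ c≡𝟘) = column-neighbour (inj₁ c≡𝟘)
  origin-neighbour (inj₂ (inj₁ d≡𝟘)) = row-neighbour (inj₁ d≡𝟘)
  origin-neighbour {c} (inj₂ (inj₂ c≡d)) with c ≟ 𝟘
  ... | yes c≡𝟘 = column-neighbour (inj₁ c≡𝟘)
  ... | no c≢𝟘 = inj₂ ((λ (𝟘≡c , _) → c≢𝟘 (sym 𝟘≡c)) ,
                     inj₂ (inj₂ (inj₁ (refl , c≡d))))

module Depth (γ : Ordinal) (lim : IsInfiniteLimit γ) (n : ℕ) where
  open Ordinal γ
  open Graph γ n
  open OrdinalProperties γ
  open Unbounded lim
  open GraphProperties γ n

  -- A neighbour (c',d') of (c,d) that is not already in N[(p,0)] satisfies
  -- c < c' and d' < d, so it is handled at depth d' by the next row p' > c', d'.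
  row-strategy : ∀ {d} → Acc _<_ d → ∀ {c p} → 𝟘 < d → c ≢ d → c < p → d < p →
                 pt c d ≤[ ↑ d ] pt p 𝟘
  row-strategy {d} (acc smaller) {c} {p} 𝟘<d c≢d c<p d<p = step beaten
    where
    beaten : ∀ x → N[ pt c d ]∋ x → x ≤[< ↑ d ]N[ pt p 𝟘 ]
    beaten _ (inj₁ refl) = ∈N⇒≤[<]N (row-neighbour (inj₂ c<p)) 𝟘<d
    beaten (neg _) (inj₂ (_ , d≡𝟘 , _)) = ⊥-elim (<⇒≢𝟘 𝟘<d d≡𝟘)
    beaten (pt c′ d′) (inj₂ (_ , edge)) with d′ ≟ 𝟘 | c′ <? p
    ... | yes d′≡𝟘 | _ = ∈N⇒≤[<]N (row-neighbour (inj₁ d′≡𝟘)) 𝟘<d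
    ... | no _ | yes c′<p = ∈N⇒≤[<]N (row-neighbour (inj₂ c′<p)) 𝟘<d
    ... | no d′≢𝟘 | no c′≮p = far edge
      where
      far : PointEdge c d c′ d′ → pt c′ d′ ≤[< ↑ d ]N[ pt p 𝟘 ]
      far (inj₁ (_ , refl)) = ⊥-elim (c′≮p (<⇒𝟘< d<p))
      far (inj₂ (inj₁ (d≡𝟘 , _))) = ⊥-elim (<⇒≢𝟘 𝟘<d d≡𝟘)
      far (inj₂ (inj₂ (inj₁ (c≡d , _)))) = ⊥-elim (c≢d c≡d)
      far (inj₂ (inj₂ (inj₂ (inj₂ (c′<c , _))))) = ⊥-elim (c′≮p (<-trans c′<c c<p))
      far (inj₂ (inj₂ (inj₂ (inj₁ (_ , d′<d))))) with upper-bound c′ d′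
      ... | p′ , c′<p′ , d′<p′ =
        pt p′ 𝟘 , row-neighbour (inj₁ refl) , ↑ d′ , ↑<↑ d′<d ,
        row-strategy (smaller d′<d) (≢𝟘⇒𝟘< d′≢𝟘)
          (λ { refl → c′≮p (<-trans d′<d d<p) }) c′<p′ d′<p′

  column-strategy : ∀ {c d q} → 𝟘 < c → c ≢ d → c < q → d < q → pt c d ≤[ ↑ c ] pt 𝟘 q
  column-strategy {c} 𝟘<c c≢d c<q d<q =
    ≤-transpose (row-strategy (wf c) 𝟘<c (c≢d ∘ sym) d<q c<q)

  point≤[<]N-origin : ∀ {s} c d → 𝟘 < s → c < s ⊎ d < s ⊎ c ≡ d →
                      pt c d ≤[< ↑ s ]N[ origin ]
  point≤[<]N-origin c d 𝟘<s shallow with c ≟ 𝟘 | d ≟ 𝟘 | compare c d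
  ... | yes c≡𝟘 | _ | _ = ∈N⇒≤[<]N (origin-neighbour (inj₁ c≡𝟘)) 𝟘<s
  ... | no _ | yes d≡𝟘 | _ = ∈N⇒≤[<]N (origin-neighbour (inj₂ (inj₁ d≡𝟘))) 𝟘<s
  ... | no _ | no _ | tri≈ _ c≡d _ = ∈N⇒≤[<]N (origin-neighbour (inj₂ (inj₂ c≡d))) 𝟘<s
  ... | no c≢𝟘 | no _ | tri< c<d c≢d _ =
    pt 𝟘 (next d) , origin-neighbour (inj₁ refl) ,
    ↑ c , ↑<↑ ([ id , [ <-trans c<d , ⊥-elim ∘ c≢d ]′ ]′ shallow) ,
    column-strategy (≢𝟘⇒𝟘< c≢𝟘) c≢d (<-trans c<d (<-next d)) (<-next d)
  ... | no _ | no d≢𝟘 | tri> _ c≢d d<c =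
    pt (next c) 𝟘 , origin-neighbour (inj₂ (inj₁ refl)) ,
    ↑ d , ↑<↑ ([ <-trans d<c , [ id , ⊥-elim ∘ c≢d ]′ ]′ shallow) ,
    row-strategy (wf d) (≢𝟘⇒𝟘< d≢𝟘) c≢d (<-next c) (<-trans d<c (<-next c))

  -- neg k is beaten by neg j through shifting its neighbours one step towards
  -- origin; the recursion ends at neg n, whence the bound n ≤ j + m on the depth.
  neg≤neg : ∀ m {j k : Fin (ℕ.suc n)} → j Fin.< k → n ℕ.≤ toℕ j ℕ.+ m →
            neg k ≤[ ↑ (finite (ℕ.suc m)) ] neg j
  neg≤neg ℕ.zero {j} {k} j<k n≤j+0 =
    ⊥-elim (ℕ.<-irrefl refl (ℕ.<-≤-trans j<k (ℕ.≤-trans (ℕ.≤-pred (Fin.toℕ<n k))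
      (ℕ.≤-trans n≤j+0 (ℕ.≤-reflexive (ℕ.+-identityʳ (toℕ j)))))))
  neg≤neg (ℕ.suc m) {j} {k} j<k n≤j+1+m = step beaten
    where
    j+1<1+n : ℕ.suc (toℕ j) ℕ.< ℕ.suc n
    j+1<1+n = ℕ.s≤s (ℕ.<-≤-trans j<k (ℕ.≤-pred (Fin.toℕ<n k)))

    j+1 : Fin (ℕ.suc n)
    j+1 = fromℕ< j+1<1+n

    toℕ-j+1 : toℕ j+1 ≡ ℕ.suc (toℕ j)
    toℕ-j+1 = Fin.toℕ-fromℕ< j+1<1+n

    above : ∀ i → toℕ j ℕ.≤ toℕ i → neg i ≤[< ↑ (finite (ℕ.suc (ℕ.suc m))) ]N[ neg j ]
    above i j≤i with ℕ.m≤n⇒m<n∨m≡n j≤i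
    ... | inj₂ j≡i =
      neg i , inj₁ (cong neg (Fin.toℕ-injective (sym j≡i))) , _ , ↑<↑ (<-next _) , refl≤
    ... | inj₁ j<i with ℕ.m≤n⇒m<n∨m≡n j<i
    ...   | inj₂ j+1≡i = neg i , inj₂ (inj₂ (sym j+1≡i)) , _ , ↑<↑ (<-next _) , refl≤
    ...   | inj₁ j+1<i =
      neg j+1 , inj₂ (inj₂ toℕ-j+1) , _ , ↑<↑ (<-next _) ,
      neg≤neg m (subst (ℕ._< toℕ i) (sym toℕ-j+1) j+1<i)
        (subst (n ℕ.≤_) (trans (ℕ.+-suc (toℕ j) m) (cong (ℕ._+ m) (sym toℕ-j+1))) n≤j+1+m)

    beaten : ∀ x → N[ neg k ]∋ x → x ≤[< ↑ (finite (ℕ.suc (ℕ.suc m))) ]N[ neg j ]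
    beaten _ (inj₁ refl) = above k (ℕ.<⇒≤ j<k)
    beaten (pt _ _) (inj₂ (_ , _ , refl)) = ⊥-elim (ℕ.n≮0 j<k)
    beaten (neg i) (inj₂ (inj₁ k≡1+i)) = above i (ℕ.≤-pred (subst (toℕ j ℕ.<_) k≡1+i j<k))
    beaten (neg i) (inj₂ (inj₂ i≡1+k)) =
      above i (subst (toℕ j ℕ.≤_) (sym i≡1+k) (ℕ.≤-trans (ℕ.<⇒≤ j<k) (ℕ.n≤1+n _)))

  neg≤[<]N-origin : ∀ {s} k → finite (ℕ.suc n) < s → neg k ≤[< ↑ s ]N[ origin ]
  neg≤[<]N-origin Fin.zero path<s = ∈N⇒≤[<]N (inj₂ (refl , refl , refl)) (<⇒𝟘< path<s)
  neg≤[<]N-origin (Fin.suc k) path<s =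
    neg Fin.zero , inj₂ (refl , refl , refl) , ↑ (finite (ℕ.suc n)) , ↑<↑ path<s ,
    neg≤neg n (ℕ.s≤s ℕ.z≤n) ℕ.≤-refl

  ≤-origin : ∀ u → ∃ λ δ → u ≤[ ↑ δ ] origin
  ≤-origin (neg k) = next path , step beaten
    where
    path : Carrier
    path = finite (ℕ.suc n)

    beaten : ∀ x → N[ neg k ]∋ x → x ≤[< ↑ (next path) ]N[ origin ]
    beaten (neg i) _ = neg≤[<]N-origin i (<-next path)
    beaten (pt _ _) (inj₂ (refl , _)) =
      point≤[<]N-origin 𝟘 _ (<⇒𝟘< (<-next path)) (inj₁ (<⇒𝟘< (<-next path)))
  ≤-origin (pt a b) with upper-bound a b
  ... | s , a<s , b<s = s , step beaten
    where
    𝟘<s : 𝟘 < s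
    𝟘<s = <⇒𝟘< a<s

    beaten : ∀ x → N[ pt a b ]∋ x → x ≤[< ↑ s ]N[ origin ]
    beaten _ (inj₁ refl) = point≤[<]N-origin a b 𝟘<s (inj₁ a<s)
    beaten (neg _) (inj₂ (refl , refl , refl)) = ∈N⇒≤[<]N (inj₂ (refl , refl , refl)) 𝟘<s
    beaten (pt c d) (inj₂ (_ , edge)) = point≤[<]N-origin c d 𝟘<s (shallow edge)
      where
      shallow : PointEdge a b c d → c < s ⊎ d < s ⊎ c ≡ d
      shallow (inj₁ (_ , refl)) = inj₁ 𝟘<s
      shallow (inj₂ (inj₁ (_ , refl))) = inj₂ (inj₁ 𝟘<s)
      shallow (inj₂ (inj₂ (inj₁ (_ , c≡d)))) = inj₂ (inj₂ c≡d)
      shallow (inj₂ (inj₂ (inj₂ (inj₁ (_ , d<b))))) = inj₂ (inj₁ (<-trans d<b b<s))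
      shallow (inj₂ (inj₂ (inj₂ (inj₂ (c<a , _))))) = inj₁ (<-trans c<a a<s)

  ≤[γ]-origin-neighbour : ∀ {x y} → N[ y ]∋ origin → x ≤[ γ̂ ] y
  ≤[γ]-origin-neighbour origin∈N = step λ z _ →
    origin , origin∈N , ↑ (proj₁ (≤-origin z)) , ↑<γ , proj₂ (≤-origin z)

  ≤[γ+1]-point : ∀ u a b → u ≤[ γ̂+1 ] pt a b
  ≤[γ+1]-point u a b = step λ _ _ →
    pt 𝟘 (next b) , N-sym (column-neighbour (inj₂ (<-next b))) , γ̂ , γ<γ+1 ,
    ≤[γ]-origin-neighbour (column-neighbour (inj₁ refl))

lemma10 : (γ : Ordinal) → IsInfiniteLimit γ → (n : ℕ) → 1 ≤ n →
    (u : Graph.V γ n) → (a b : Ordinal.Carrier γ) →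
    Σ (Graph.Idx γ n) (λ α → Graph._≤[_]_ γ n u α (Graph.pt a b))
    × Σ (Ordinal.Carrier γ)
    (λ δ → Graph._≤[_]_ γ n u (Graph.↑ δ)
    (Graph.pt (Ordinal.𝟘 γ) (Ordinal.𝟘 γ)))
-- The argument does not need 1 ≤ n.
lemma10 γ lim n _ u a b = (γ̂+1 , ≤[γ+1]-point u a b) , ≤-origin u
  where open Graph γ n using (γ̂+1)
        open Depth γ lim n
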